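{- Let $d$ be a positive integer, let $V:=\{0,1,2\}^d$, and for $i=0,1,\dots,d$ let $V_i$ be the set of vectors in $V$ with precisely $i$ entries equal to $1$. Then the image $W^1_dS^{2^d}_2=\{W^1_dx : x\in S^{2^d}_2\}$ equals $V\setminus V_0$, the set of vertices of ${\rm conv}(W^1_dS^{2^d}_2)$ equals $V_1$, and therefore $u^1_2(d)=d2^{d-1}$.
   Context: For $n\ge r$, $S^n_r\subset\{0,1\}^n$ denotes the set of all $x\in\{0,1\}^n$ with exactly $r$ entries equal to $1$ (the uniform matroid). $W^k_d$ denotes the $d\times k2^d$ $\{0,1\}$-matrix whose columns consist of exactly $k$ copies of each vector in $\{0,1\}^d$; so $W^1_d$ has as columns each vector of $\{0,1\}^d$ exactly once. $u^k_r(d)$ denotes the number of vertices of ${\rm conv}(W^k_dS^{k2^d}_r)$.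
   Formalization: The convex hull of the image, its vertices and the vertex count are taken in ℚ^d rather than ℝ^d. -}

module Defs where

open import Data.Nat as ℕ using (ℕ; zero; suc; _^_; _/_; _%_; _≤_)
open import Data.Nat.Base using (NonZero)
open import Data.Fin using (Fin; toℕ)
open import Data.Vec using (Vec; []; _∷_; zipWith; replicate; map; tabulate; lookup)
open import Data.List as List using (List; []; _∷_; length)
open import Data.List.Membership.Propositional using (_∈_)
open import Data.List.Relation.Unary.Unique.Propositional using (Unique)
open import Data.List.Relation.Unary.All using (All)
open import Data.Integer using (+_)
open import Data.Rational as ℚ using (ℚ; 0ℚ; 1ℚ)
open import Data.Product using (Σ; ∃; _×_; _,_)
open import Data.Sum using (_⊎_)
open import Relation.Binary.PropositionalEquality using (_≡_)
open import Relation.Nullary using (¬_)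
open import Function.Bundles using (_⇔_)

Σℕ : (n : ℕ) → (Fin n → ℕ) → ℕ
Σℕ zero    f = 0
Σℕ (suc n) f = f Fin.zero ℕ.+ Σℕ n (λ i → f (Fin.suc i))
  where import Data.Fin as Fin

count : {n : ℕ} → ℕ → Vec ℕ n → ℕ
count a []       = 0
count a (x ∷ xs) with x ℕ.≟ a
... | Relation.Nullary.yes _ = suc (count a xs)
... | Relation.Nullary.no  _ = count a xs

IsBinary : {n : ℕ} → Vec ℕ n → Set
IsBinary {n} x = (i : Fin n) → lookup x i ≡ 0 ⊎ lookup x i ≡ 1

S : (n r : ℕ) → Vec ℕ n → Set
S n r x = IsBinary x × count 1 x ≡ r

-- W^k_d : d × (k 2^d) matrix whose columns are exactly k copies of each
-- vector of {0,1}^d.  Column j is the binary expansion (bits 0..d-1) of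
-- (j mod 2^d); as j ranges over 0..k2^d-1 each vector of {0,1}^d occurs
-- exactly k times.

2^d-nonzero : (d : ℕ) → NonZero (2 ^ d)
2^d-nonzero d = ℕ.>-nonZero (Data.Nat.Properties.m^n>0 2 d)
  where import Data.Nat.Properties

_mod2^_ : ℕ → ℕ → ℕ
n mod2^ d = ℕ._%_ n (2 ^ d) {{2^d-nonzero d}}

bit : ℕ → ℕ → ℕ
bit n i = ℕ._/_ n (2 ^ i) {{2^d-nonzero i}} % 2

W : (k d : ℕ) → Fin d → Fin (k ℕ.* 2 ^ d) → ℕ
W k d i j = bit (toℕ j mod2^ d) (toℕ i)

_·ᵥ_ : {k d : ℕ} → (Fin d → Fin (k ℕ.* 2 ^ d) → ℕ) → Vec ℕ (k ℕ.* 2 ^ d) → Vec ℕ d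
M ·ᵥ x = tabulate (λ i → Σℕ _ (λ j → M i j ℕ.* lookup x j))

Image : (k d r : ℕ) → Vec ℕ d → Set
Image k d r v = ∃ λ x → S (k ℕ.* 2 ^ d) r x × (_·ᵥ_ {k} {d} (W k d) x) ≡ v

InV : {d : ℕ} → Vec ℕ d → Set
InV {d} v = (i : Fin d) → lookup v i ≤ 2

InVi : {d : ℕ} → ℕ → Vec ℕ d → Set
InVi i v = InV v × count 1 v ≡ i

toℚ : ℕ → ℚ
toℚ n = + n ℚ./ 1

embed : {d : ℕ} → Vec ℕ d → Vec ℚ d
embed = map toℚ

_+ᵥ_ : {d : ℕ} → Vec ℚ d → Vec ℚ d → Vec ℚ d
_+ᵥ_ = zipWith ℚ._+_

_∙ᵥ_ : {d : ℕ} → ℚ → Vec ℚ d → Vec ℚ d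
t ∙ᵥ v = map (t ℚ.*_) v

combo : {d : ℕ} → List (ℚ × Vec ℚ d) → Vec ℚ d
combo {d} []             = replicate d 0ℚ
combo     ((t , p) ∷ cs) = (t ∙ᵥ p) +ᵥ combo cs

coeffSum : {d : ℕ} → List (ℚ × Vec ℚ d) → ℚ
coeffSum []             = 0ℚ
coeffSum ((t , _) ∷ cs) = t ℚ.+ coeffSum cs

Conv : {d : ℕ} → (Vec ℚ d → Set) → Vec ℚ d → Set
Conv {d} P w = ∃ λ (cs : List (ℚ × Vec ℚ d)) →
  All (λ c → 0ℚ ℚ.≤ Data.Product.proj₁ c × P (Data.Product.proj₂ c)) cs
  × coeffSum cs ≡ 1ℚ × combo cs ≡ w

IsVertex : {d : ℕ} → (Vec ℚ d → Set) → Vec ℚ d → Set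
IsVertex C w = C w × (∀ a b t → C a → C b → 0ℚ ℚ.< t → t ℚ.< 1ℚ →
  w ≡ (t ∙ᵥ a) +ᵥ ((1ℚ ℚ.- t) ∙ᵥ b) → a ≡ w × b ≡ w)

ImageQ : (k d r : ℕ) → Vec ℚ d → Set
ImageQ k d r w = ∃ λ v → Image k d r v × embed v ≡ w

HasCard : {A : Set} → (A → Set) → ℕ → Set
HasCard {A} P n = ∃ λ (xs : List A) → Unique xs × (∀ a → a ∈ xs ⇔ P a) × length xs ≡ n

u≡ : (k r d n : ℕ) → Set
u≡ k r d n = HasCard (IsVertex (Conv (ImageQ k d r))) n

-- The columns of W¹_d are the 0/1-vectors of length d, each exactly once, so W¹_d S₂ consists of
-- the sums of two distinct 0/1-vectors. These are exactly the vectors of {0,1,2}^d with an entry 1: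
-- split each entry y as (y ⊓ 1) + (y ∸ 1), two 0/1-vectors that differ where y = 1.
-- Every vertex of the hull of a set lies in the set. A point of the image with two entries 1 is the
-- midpoint of the image points obtained by changing one of them to 0 and to 2, so it is no vertex;
-- a point v with a single entry 1 is the unique maximiser over the image of u ↦ ⟨v - 𝟙, u⟩, hence a
-- vertex. Finally |V₁| = d 2^(d-1): a position for the 1, and a choice in {0,2} for each other entry.

module Submission where

open import Defs
open import Data.Nat using (ℕ; zero; suc; _+_; _*_; _^_; _∸_; _⊓_; _≤_; _<_; z≤n; s≤s)
import Data.Nat as ℕ
import Data.Nat.Properties as ℕₚ
open import Data.Nat.DivMod using (_/_; _%_; m*n%n≡0; [m+kn]%n≡m%n; m*n/n≡m; +-distrib-/;
  m/n/o≡m/[n*o]; m<n*o⇒m/o<n; m≡m%n+[m/n]*n; m%n<n; n/1≡n; m<n⇒m%n≡m)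
import Data.Nat.Coprimality as Coprimality
import Data.Integer as ℤ
import Data.Integer.Properties as ℤ
open import Data.Rational as ℚ using (ℚ; 0ℚ; 1ℚ; ½)
import Data.Rational.Properties as ℚₚ
open import Data.Rational.Solver using (module +-*-Solver)
open import Data.Fin using (Fin; zero; suc; toℕ; fromℕ<)
import Data.Fin.Properties as Finₚ
open import Data.Vec using (Vec; []; _∷_; lookup; tabulate; map; replicate; _[_]≔_)
import Data.Vec.Properties as Vecₚ
open import Data.Vec.Relation.Binary.Pointwise.Extensional using (ext; Pointwise-≡⇒≡)
open import Data.List as List using (List; []; _∷_; _++_; length)
import Data.List.Properties as Listₚ
open import Data.List.Membership.Propositional using (_∈_)
open import Data.List.Membership.Propositional.Properties using (∈-map⁺; ∈-map⁻; ∈-++⁺ˡ; ∈-++⁺ʳ; ∈-++⁻)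
open import Data.List.Relation.Unary.All using (All; []; _∷_)
open import Data.List.Relation.Unary.AllPairs using ([]; _∷_)
open import Data.List.Relation.Unary.Any using (here)
open import Data.List.Relation.Unary.Unique.Propositional using (Unique)
import Data.List.Relation.Unary.Unique.Propositional.Properties as Uniqueₚ
open import Data.Product using (_×_; _,_; proj₁; proj₂; ∃; ∃₂)
open import Data.Sum using (_⊎_; inj₁; inj₂)
open import Data.Empty using (⊥-elim)
open import Data.Unit using (tt)
open import Function using (_∘_)
open import Function.Bundles using (_⇔_; mk⇔; Equivalence)
open import Relation.Nullary using (¬_; yes; no)
open import Relation.Binary.Definitions using (tri<; tri≈; tri>)
open import Relation.Binary.PropositionalEquality
open +-*-Solver

≤⇒≡∨< : ∀ {p q} → p ℚ.≤ q → p ≡ q ⊎ p ℚ.< q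
≤⇒≡∨< {p} {q} p≤q with ℚₚ.<-cmp p q
... | tri< p<q _ _ = inj₂ p<q
... | tri≈ _ p≡q _ = inj₁ p≡q
... | tri> _ _ p>q = ⊥-elim (ℚₚ.<-irrefl refl (ℚₚ.<-≤-trans p>q p≤q))

+-≤-tight : ∀ {x x′ y y′} → x ℚ.≤ x′ → y ℚ.≤ y′ → x ℚ.+ y ≡ x′ ℚ.+ y′ → x ≡ x′ × y ≡ y′
+-≤-tight x≤x′ y≤y′ eq =
  ℚₚ.≤-antisym x≤x′ (ℚₚ.≮⇒≥ λ x<x′ → ℚₚ.<-irrefl eq (ℚₚ.+-mono-<-≤ x<x′ y≤y′)) ,
  ℚₚ.≤-antisym y≤y′ (ℚₚ.≮⇒≥ λ y<y′ → ℚₚ.<-irrefl eq (ℚₚ.+-mono-≤-< x≤x′ y<y′))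

*-cancelˡ-≡-pos : ∀ r .{{_ : ℚ.Positive r}} {p q} → r ℚ.* p ≡ r ℚ.* q → p ≡ q
*-cancelˡ-≡-pos r eq =
  ℚₚ.≤-antisym (ℚₚ.*-cancelˡ-≤-pos r (ℚₚ.≤-reflexive eq)) (ℚₚ.*-cancelˡ-≤-pos r (ℚₚ.≤-reflexive (sym eq)))

x+y≡z⇒y≡z-x : ∀ x {y z} → x ℚ.+ y ≡ z → y ≡ z ℚ.- x
x+y≡z⇒y≡z-x x {y} refl = solve 2 (λ x y → y := x :+ y :- x) refl x y

p<1⇒0<1-p : ∀ {p} → p ℚ.< 1ℚ → 0ℚ ℚ.< 1ℚ ℚ.- p
p<1⇒0<1-p {p} p<1 = subst (ℚ._< 1ℚ ℚ.- p) (ℚₚ.+-inverseʳ p) (ℚₚ.+-monoˡ-< (ℚ.- p) p<1)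

0ᵥ : (d : ℕ) → Vec ℚ d
0ᵥ d = replicate d 0ℚ

+ᵥ-identityˡ : ∀ {d} (x : Vec ℚ d) → 0ᵥ d +ᵥ x ≡ x
+ᵥ-identityˡ = Vecₚ.zipWith-identityˡ ℚₚ.+-identityˡ

+ᵥ-identityʳ : ∀ {d} (x : Vec ℚ d) → x +ᵥ 0ᵥ d ≡ x
+ᵥ-identityʳ = Vecₚ.zipWith-identityʳ ℚₚ.+-identityʳ

∙ᵥ-identityˡ : ∀ {d} (x : Vec ℚ d) → 1ℚ ∙ᵥ x ≡ x
∙ᵥ-identityˡ x = trans (Vecₚ.map-cong ℚₚ.*-identityˡ x) (Vecₚ.map-id x)

∙ᵥ-zeroˡ : ∀ {d} (x : Vec ℚ d) → 0ℚ ∙ᵥ x ≡ 0ᵥ d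
∙ᵥ-zeroˡ x = trans (Vecₚ.map-cong ℚₚ.*-zeroˡ x) (Vecₚ.map-const x 0ℚ)

∙ᵥ-zeroʳ : ∀ d s → s ∙ᵥ 0ᵥ d ≡ 0ᵥ d
∙ᵥ-zeroʳ d s = trans (Vecₚ.map-replicate (s ℚ.*_) 0ℚ d) (cong (replicate d) (ℚₚ.*-zeroʳ s))

∙ᵥ-assoc : ∀ {d} s t (x : Vec ℚ d) → s ∙ᵥ (t ∙ᵥ x) ≡ (s ℚ.* t) ∙ᵥ x
∙ᵥ-assoc s t x = trans (sym (Vecₚ.map-∘ (s ℚ.*_) (t ℚ.*_) x)) (Vecₚ.map-cong (λ a → sym (ℚₚ.*-assoc s t a)) x)

∙ᵥ-distribˡ : ∀ {d} s (x y : Vec ℚ d) → s ∙ᵥ (x +ᵥ y) ≡ (s ∙ᵥ x) +ᵥ (s ∙ᵥ y)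
∙ᵥ-distribˡ s []      []      = refl
∙ᵥ-distribˡ s (a ∷ x) (b ∷ y) = cong₂ _∷_ (ℚₚ.*-distribˡ-+ s a b) (∙ᵥ-distribˡ s x y)

∙ᵥ-distribʳ : ∀ {d} s t (x : Vec ℚ d) → (s ∙ᵥ x) +ᵥ (t ∙ᵥ x) ≡ (s ℚ.+ t) ∙ᵥ x
∙ᵥ-distribʳ s t []      = refl
∙ᵥ-distribʳ s t (a ∷ x) = cong₂ _∷_ (sym (ℚₚ.*-distribʳ-+ a s t)) (∙ᵥ-distribʳ s t x)

⟨_∣_⟩ : ∀ {d} → Vec ℚ d → Vec ℚ d → ℚ
⟨ []     ∣ []     ⟩ = 0ℚ
⟨ c ∷ cs ∣ x ∷ xs ⟩ = c ℚ.* x ℚ.+ ⟨ cs ∣ xs ⟩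

⟨⟩-0ᵥ : ∀ {d} (c : Vec ℚ d) → ⟨ c ∣ 0ᵥ d ⟩ ≡ 0ℚ
⟨⟩-0ᵥ []       = refl
⟨⟩-0ᵥ (c ∷ cs) = trans (cong₂ ℚ._+_ (ℚₚ.*-zeroʳ c) (⟨⟩-0ᵥ cs)) (ℚₚ.+-identityʳ 0ℚ)

⟨⟩-+ᵥ : ∀ {d} (c x y : Vec ℚ d) → ⟨ c ∣ x +ᵥ y ⟩ ≡ ⟨ c ∣ x ⟩ ℚ.+ ⟨ c ∣ y ⟩
⟨⟩-+ᵥ []       []      []      = refl
⟨⟩-+ᵥ (c ∷ cs) (a ∷ x) (b ∷ y) =
  trans (cong (c ℚ.* (a ℚ.+ b) ℚ.+_) (⟨⟩-+ᵥ cs x y))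
    (solve 5 (λ c a b u v → c :* (a :+ b) :+ (u :+ v) := c :* a :+ u :+ (c :* b :+ v))
      refl c a b ⟨ cs ∣ x ⟩ ⟨ cs ∣ y ⟩)

⟨⟩-∙ᵥ : ∀ {d} (c : Vec ℚ d) t x → ⟨ c ∣ t ∙ᵥ x ⟩ ≡ t ℚ.* ⟨ c ∣ x ⟩
⟨⟩-∙ᵥ []       t []      = sym (ℚₚ.*-zeroʳ t)
⟨⟩-∙ᵥ (c ∷ cs) t (a ∷ x) =
  trans (cong (c ℚ.* (t ℚ.* a) ℚ.+_) (⟨⟩-∙ᵥ cs t x))
    (solve 4 (λ c t a u → c :* (t :* a) :+ t :* u := t :* (c :* a :+ u)) refl c t a ⟨ cs ∣ x ⟩)

Weighted : ∀ {d} → (Vec ℚ d → Set) → ℚ × Vec ℚ d → Set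
Weighted P c = 0ℚ ℚ.≤ proj₁ c × P (proj₂ c)

Extreme : ∀ {d} → (Vec ℚ d → Set) → Vec ℚ d → Set
Extreme C w = ∀ a b t → C a → C b → 0ℚ ℚ.< t → t ℚ.< 1ℚ →
  w ≡ (t ∙ᵥ a) +ᵥ ((1ℚ ℚ.- t) ∙ᵥ b) → a ≡ w × b ≡ w

∙ᵥ-1/-cancel : ∀ {d} s .{{_ : ℚ.NonZero s}} (x : Vec ℚ d) → s ∙ᵥ ((ℚ.1/ s) ∙ᵥ x) ≡ x
∙ᵥ-1/-cancel s x = begin
  s ∙ᵥ ((ℚ.1/ s) ∙ᵥ x)    ≡⟨ ∙ᵥ-assoc s (ℚ.1/ s) x ⟩
  (s ℚ.* ℚ.1/ s) ∙ᵥ x   ≡⟨ cong (_∙ᵥ x) (ℚₚ.*-inverseʳ s) ⟩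
  1ℚ ∙ᵥ x               ≡⟨ ∙ᵥ-identityˡ x ⟩
  x                     ∎
  where open ≡-Reasoning

combo-∷-null : ∀ {d} (p : Vec ℚ d) cs → combo ((0ℚ , p) ∷ cs) ≡ combo cs
combo-∷-null p cs = trans (cong (_+ᵥ combo cs) (∙ᵥ-zeroˡ p)) (+ᵥ-identityˡ (combo cs))

module _ {d : ℕ} {P : Vec ℚ d → Set} where

  open ≡-Reasoning

  coeffSum-nonNeg : ∀ {cs} → All (Weighted P) cs → 0ℚ ℚ.≤ coeffSum cs
  coeffSum-nonNeg []               = ℚₚ.≤-refl
  coeffSum-nonNeg ((0≤t , _) ∷ ws) = ℚₚ.+-mono-≤ 0≤t (coeffSum-nonNeg ws)

  combo-null : ∀ {cs} → All (Weighted P) cs → coeffSum cs ≡ 0ℚ → combo cs ≡ 0ᵥ d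
  combo-null {[]}            []               _   = refl
  combo-null {(t , p) ∷ cs} ((0≤t , _) ∷ ws) Σ≡0 = begin
    (t ∙ᵥ p) +ᵥ combo cs   ≡⟨ cong₂ _+ᵥ_ (cong (_∙ᵥ p) (sym 0≡t)) (combo-null ws (sym 0≡Σ)) ⟩
    (0ℚ ∙ᵥ p) +ᵥ 0ᵥ d      ≡⟨ +ᵥ-identityʳ _ ⟩
    0ℚ ∙ᵥ p                ≡⟨ ∙ᵥ-zeroˡ p ⟩
    0ᵥ d                   ∎
    where
    0≡t×0≡Σ = +-≤-tight 0≤t (coeffSum-nonNeg ws) (sym Σ≡0)
    0≡t = proj₁ 0≡t×0≡Σ
    0≡Σ = proj₂ 0≡t×0≡Σ

  rescale : ℚ → List (ℚ × Vec ℚ d) → List (ℚ × Vec ℚ d)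
  rescale s = List.map (λ c → s ℚ.* proj₁ c , proj₂ c)

  combo-rescale : ∀ s cs → combo (rescale s cs) ≡ s ∙ᵥ combo cs
  combo-rescale s []             = sym (∙ᵥ-zeroʳ d s)
  combo-rescale s ((t , p) ∷ cs) = begin
    ((s ℚ.* t) ∙ᵥ p) +ᵥ combo (rescale s cs)  ≡⟨ cong₂ _+ᵥ_ (sym (∙ᵥ-assoc s t p)) (combo-rescale s cs) ⟩
    (s ∙ᵥ (t ∙ᵥ p)) +ᵥ (s ∙ᵥ combo cs)        ≡⟨ sym (∙ᵥ-distribˡ s (t ∙ᵥ p) (combo cs)) ⟩
    s ∙ᵥ ((t ∙ᵥ p) +ᵥ combo cs)               ∎

  coeffSum-rescale : ∀ s cs → coeffSum (rescale s cs) ≡ s ℚ.* coeffSum cs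
  coeffSum-rescale s []             = sym (ℚₚ.*-zeroʳ s)
  coeffSum-rescale s ((t , p) ∷ cs) =
    trans (cong (s ℚ.* t ℚ.+_) (coeffSum-rescale s cs)) (sym (ℚₚ.*-distribˡ-+ s t (coeffSum cs)))

  All-rescale : ∀ {s cs} → 0ℚ ℚ.≤ s → All (Weighted P) cs → All (Weighted P) (rescale s cs)
  All-rescale         0≤s []                = []
  All-rescale {s} {(t , _) ∷ _} 0≤s ((0≤t , Pp) ∷ ws) = (0≤st , Pp) ∷ All-rescale 0≤s ws
    where
    0≤st = ℚₚ.nonNegative⁻¹ _ {{ℚₚ.nonNeg*nonNeg⇒nonNeg s {{ℚ.nonNegative 0≤s}} t {{ℚ.nonNegative 0≤t}}}}

  Conv-singleton : ∀ {p} → P p → Conv P p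
  Conv-singleton {p} Pp =
    (1ℚ , p) ∷ [] , (ℚₚ.≤ᵇ⇒≤ tt , Pp) ∷ [] , refl , trans (+ᵥ-identityʳ _) (∙ᵥ-identityˡ p)

  Conv-normalise : ∀ {cs} s .{{_ : ℚ.NonZero s}} → All (Weighted P) cs → coeffSum cs ≡ s →
    Conv P ((ℚ.1/ s) ∙ᵥ combo cs)
  Conv-normalise {cs} s ws Σ≡s =
    rescale (ℚ.1/ s) cs , All-rescale 0≤1/s ws ,
    trans (coeffSum-rescale (ℚ.1/ s) cs) (trans (cong (ℚ.1/ s ℚ.*_) Σ≡s) (ℚₚ.*-inverseˡ s)) ,
    combo-rescale (ℚ.1/ s) cs
    where
    instance
      s-nonNeg : ℚ.NonNegative s
      s-nonNeg = ℚ.nonNegative (subst (0ℚ ℚ.≤_) Σ≡s (coeffSum-nonNeg ws))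
      s-pos : ℚ.Positive s
      s-pos = ℚₚ.nonNeg∧nonZero⇒pos s
    0≤1/s : 0ℚ ℚ.≤ ℚ.1/ s
    0≤1/s = ℚₚ.<⇒≤ (ℚₚ.positive⁻¹ _ {{ℚₚ.1/pos⇒pos s}})

  head-weight≤1 : ∀ {t p cs} → All (Weighted P) ((t , p) ∷ cs) → coeffSum ((t , p) ∷ cs) ≡ 1ℚ → t ℚ.≤ 1ℚ
  head-weight≤1 {t} (_ ∷ ws) Σ≡1 = subst (t ℚ.≤_) Σ≡1
    (ℚₚ.≤-trans (ℚₚ.≤-reflexive (sym (ℚₚ.+-identityʳ t))) (ℚₚ.+-monoʳ-≤ t (coeffSum-nonNeg ws)))

  -- A combination with a weight t ∈ (0,1) on p is t p + (1 - t) q for the normalised rest q,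
  -- so extremality forces p = w; weights 0 drop out.
  extreme-combo∈ : ∀ {w} → Extreme (Conv P) w →
    ∀ {cs} → All (Weighted P) cs → coeffSum cs ≡ 1ℚ → combo cs ≡ w → P w
  extreme-combo∈ {w} extreme {(t , p) ∷ cs} ws@((0≤t , Pp) ∷ ws′) Σ≡1 combo≡w
    with ≤⇒≡∨< 0≤t | ≤⇒≡∨< (head-weight≤1 ws Σ≡1)
  ... | inj₁ refl | _ =
    extreme-combo∈ extreme ws′ (trans (sym (ℚₚ.+-identityˡ _)) Σ≡1) (trans (sym (combo-∷-null p cs)) combo≡w)
  ... | inj₂ _ | inj₁ refl = subst P p≡w Pp
    where
    Σcs≡0 : coeffSum cs ≡ 0ℚ
    Σcs≡0 = trans (x+y≡z⇒y≡z-x 1ℚ Σ≡1) (ℚₚ.+-inverseʳ 1ℚ)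
    p≡w : p ≡ w
    p≡w = begin
      p                            ≡⟨ sym (∙ᵥ-identityˡ p) ⟩
      1ℚ ∙ᵥ p                      ≡⟨ sym (+ᵥ-identityʳ (1ℚ ∙ᵥ p)) ⟩
      (1ℚ ∙ᵥ p) +ᵥ 0ᵥ d            ≡⟨ cong ((1ℚ ∙ᵥ p) +ᵥ_) (sym (combo-null ws′ Σcs≡0)) ⟩
      (1ℚ ∙ᵥ p) +ᵥ combo cs        ≡⟨ combo≡w ⟩
      w                            ∎
  ... | inj₂ 0<t | inj₂ t<1 = subst P (proj₁ (extreme p q t (Conv-singleton Pp) Conv-q 0<t t<1 w≡)) Pp
    where
    s = 1ℚ ℚ.- t
    instance
      s-nonZero : ℚ.NonZero s
      s-nonZero = ℚₚ.pos⇒nonZero s {{ℚ.positive (p<1⇒0<1-p t<1)}}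
    q = (ℚ.1/ s) ∙ᵥ combo cs
    Conv-q : Conv P q
    Conv-q = Conv-normalise s ws′ (x+y≡z⇒y≡z-x t Σ≡1)
    w≡ : w ≡ (t ∙ᵥ p) +ᵥ (s ∙ᵥ q)
    w≡ = trans (sym combo≡w) (cong ((t ∙ᵥ p) +ᵥ_) (sym (∙ᵥ-1/-cancel s (combo cs))))

  vertex∈ : ∀ {w} → IsVertex (Conv P) w → P w
  vertex∈ ((cs , ws , Σ≡1 , combo≡w) , extreme) = extreme-combo∈ extreme ws Σ≡1 combo≡w

  module Exposed (c w : Vec ℚ d)
    (bound  : ∀ {p} → P p → ⟨ c ∣ p ⟩ ℚ.≤ ⟨ c ∣ w ⟩)
    (unique : ∀ {p} → P p → ⟨ c ∣ p ⟩ ≡ ⟨ c ∣ w ⟩ → p ≡ w) where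

    private
      M = ⟨ c ∣ w ⟩

      ⟨⟩-cons : ∀ t p cs → ⟨ c ∣ (t ∙ᵥ p) +ᵥ combo cs ⟩ ≡ t ℚ.* ⟨ c ∣ p ⟩ ℚ.+ ⟨ c ∣ combo cs ⟩
      ⟨⟩-cons t p cs = trans (⟨⟩-+ᵥ c (t ∙ᵥ p) (combo cs)) (cong (ℚ._+ ⟨ c ∣ combo cs ⟩) (⟨⟩-∙ᵥ c t p))

      weighted-bound : ∀ {t p} → 0ℚ ℚ.≤ t → P p → t ℚ.* ⟨ c ∣ p ⟩ ℚ.≤ t ℚ.* M
      weighted-bound {t} 0≤t Pp = ℚₚ.*-monoˡ-≤-nonNeg t {{ℚ.nonNegative 0≤t}} (bound Pp)

    combo-bound : ∀ {cs} → All (Weighted P) cs → ⟨ c ∣ combo cs ⟩ ℚ.≤ coeffSum cs ℚ.* M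
    combo-bound []                       = ℚₚ.≤-reflexive (trans (⟨⟩-0ᵥ c) (sym (ℚₚ.*-zeroˡ M)))
    combo-bound {(t , p) ∷ cs} ((0≤t , Pp) ∷ ws) =
      subst₂ ℚ._≤_ (sym (⟨⟩-cons t p cs)) (sym (ℚₚ.*-distribʳ-+ M t (coeffSum cs)))
        (ℚₚ.+-mono-≤ (weighted-bound 0≤t Pp) (combo-bound ws))

    -- Equality in the bound forces every point of positive weight to be w.
    combo-tight : ∀ {cs} → All (Weighted P) cs → ⟨ c ∣ combo cs ⟩ ≡ coeffSum cs ℚ.* M →
      combo cs ≡ coeffSum cs ∙ᵥ w
    combo-tight []                                _  = sym (∙ᵥ-zeroˡ w)
    combo-tight {(t , p) ∷ cs} ((0≤t , Pp) ∷ ws) eq =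
      trans (cong₂ _+ᵥ_ head-tight (combo-tight ws (proj₂ tight))) (∙ᵥ-distribʳ t (coeffSum cs) w)
      where
      tight = +-≤-tight (weighted-bound 0≤t Pp) (combo-bound ws)
        (trans (sym (⟨⟩-cons t p cs)) (trans eq (ℚₚ.*-distribʳ-+ M t (coeffSum cs))))
      head-tight : t ∙ᵥ p ≡ t ∙ᵥ w
      head-tight with ≤⇒≡∨< 0≤t
      ... | inj₁ refl = trans (∙ᵥ-zeroˡ p) (sym (∙ᵥ-zeroˡ w))
      ... | inj₂ 0<t  = cong (t ∙ᵥ_) (unique Pp (*-cancelˡ-≡-pos t {{ℚ.positive 0<t}} (proj₁ tight)))

    Conv-bound : ∀ {a} → Conv P a → ⟨ c ∣ a ⟩ ℚ.≤ M
    Conv-bound (cs , ws , Σ≡1 , combo≡a) =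
      subst₂ ℚ._≤_ (cong ⟨ c ∣_⟩ combo≡a) (trans (cong (ℚ._* M) Σ≡1) (ℚₚ.*-identityˡ M)) (combo-bound ws)

    Conv-tight : ∀ {a} → Conv P a → ⟨ c ∣ a ⟩ ≡ M → a ≡ w
    Conv-tight (cs , ws , Σ≡1 , combo≡a) eq = begin
      _                  ≡⟨ sym combo≡a ⟩
      combo cs           ≡⟨ combo-tight ws (trans (cong ⟨ c ∣_⟩ combo≡a) (trans eq M≡ΣM)) ⟩
      coeffSum cs ∙ᵥ w   ≡⟨ cong (_∙ᵥ w) Σ≡1 ⟩
      1ℚ ∙ᵥ w            ≡⟨ ∙ᵥ-identityˡ w ⟩
      w                  ∎
      where
      M≡ΣM : M ≡ coeffSum cs ℚ.* M
      M≡ΣM = sym (trans (cong (ℚ._* M) Σ≡1) (ℚₚ.*-identityˡ M))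

    exposed⇒vertex : P w → IsVertex (Conv P) w
    exposed⇒vertex Pw = Conv-singleton Pw , extreme
      where
      extreme : Extreme (Conv P) w
      extreme a b t Ca Cb 0<t t<1 w≡ =
        Conv-tight Ca (*-cancelˡ-≡-pos t {{ℚ.positive 0<t}} (proj₁ tight)) ,
        Conv-tight Cb (*-cancelˡ-≡-pos s {{ℚ.positive 0<s}} (proj₂ tight))
        where
        s = 1ℚ ℚ.- t
        0<s = p<1⇒0<1-p t<1
        M≡ : t ℚ.* ⟨ c ∣ a ⟩ ℚ.+ s ℚ.* ⟨ c ∣ b ⟩ ≡ t ℚ.* M ℚ.+ s ℚ.* M
        M≡ = begin
          t ℚ.* ⟨ c ∣ a ⟩ ℚ.+ s ℚ.* ⟨ c ∣ b ⟩  ≡⟨ sym (cong₂ ℚ._+_ (⟨⟩-∙ᵥ c t a) (⟨⟩-∙ᵥ c s b)) ⟩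
          ⟨ c ∣ t ∙ᵥ a ⟩ ℚ.+ ⟨ c ∣ s ∙ᵥ b ⟩    ≡⟨ sym (⟨⟩-+ᵥ c (t ∙ᵥ a) (s ∙ᵥ b)) ⟩
          ⟨ c ∣ (t ∙ᵥ a) +ᵥ (s ∙ᵥ b) ⟩        ≡⟨ cong ⟨ c ∣_⟩ (sym w≡) ⟩
          M                                   ≡⟨ solve 2 (λ m t → m := t :* m :+ (con 1ℚ :- t) :* m) refl M t ⟩
          t ℚ.* M ℚ.+ s ℚ.* M                 ∎
        tight = +-≤-tight (ℚₚ.*-monoˡ-≤-nonNeg t {{ℚ.nonNegative (ℚₚ.<⇒≤ 0<t)}} (Conv-bound Ca))
                          (ℚₚ.*-monoˡ-≤-nonNeg s {{ℚ.nonNegative (ℚₚ.<⇒≤ 0<s)}} (Conv-bound Cb)) M≡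

HasCard-image : ∀ {A B : Set} {P : A → Set} {Q : B → Set} {n} (f : A → B) → (∀ {x y} → f x ≡ f y → x ≡ y) →
  (∀ b → Q b ⇔ ∃ λ a → P a × f a ≡ b) → HasCard P n → HasCard Q n
HasCard-image {Q = Q} f f-injective Q⇔image (xs , xs-unique , xs⇔P , length≡n) =
  List.map f xs , Uniqueₚ.map⁺ f-injective xs-unique , (λ b → mk⇔ (to b) (from b)) ,
  trans (Listₚ.length-map f xs) length≡n
  where
  to : ∀ b → b ∈ List.map f xs → Q b
  to b b∈ = let a , a∈ , b≡fa = ∈-map⁻ f b∈ in
    Equivalence.from (Q⇔image b) (a , Equivalence.to (xs⇔P a) a∈ , sym b≡fa)
  from : ∀ b → Q b → b ∈ List.map f xs
  from b Qb = let a , Pa , fa≡b = Equivalence.to (Q⇔image b) Qb in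
    subst (_∈ List.map f xs) fa≡b (∈-map⁺ f (Equivalence.from (xs⇔P a) Pa))

pairing : ∀ {n} → (Fin n → ℕ) → Vec ℕ n → ℕ
pairing {n} f x = Σℕ n (λ k → f k * lookup x k)

unit : ∀ {n} → Fin n → Vec ℕ n
unit {suc n} zero    = 1 ∷ replicate n 0
unit         (suc j) = 0 ∷ unit j

-- pair i j = unit i + unit j, also when i = j.
pair : ∀ {n} → Fin n → Fin n → Vec ℕ n
pair {suc n} zero    zero    = 2 ∷ replicate n 0
pair         zero    (suc j) = 1 ∷ unit j
pair         (suc i) zero    = 1 ∷ unit i
pair         (suc i) (suc j) = 0 ∷ pair i j

pairing-zeros : ∀ {n} (f : Fin n → ℕ) → pairing f (replicate n 0) ≡ 0
pairing-zeros {zero}  f = refl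
pairing-zeros {suc n} f = cong₂ _+_ (ℕₚ.*-zeroʳ (f zero)) (pairing-zeros (f ∘ suc))

pairing-unit : ∀ {n} (f : Fin n → ℕ) j → pairing f (unit j) ≡ f j
pairing-unit f zero    = trans (cong₂ _+_ (ℕₚ.*-identityʳ (f zero)) (pairing-zeros (f ∘ suc))) (ℕₚ.+-identityʳ _)
pairing-unit f (suc j) = cong₂ _+_ (ℕₚ.*-zeroʳ (f zero)) (pairing-unit (f ∘ suc) j)

pairing-pair : ∀ {n} (f : Fin n → ℕ) i j → pairing f (pair i j) ≡ f i + f j
pairing-pair f zero    zero    = begin
  f zero * 2 + pairing (f ∘ suc) (replicate _ 0)  ≡⟨ cong (f zero * 2 +_) (pairing-zeros (f ∘ suc)) ⟩
  f zero * 2 + 0                                 ≡⟨ ℕₚ.+-identityʳ _ ⟩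
  f zero * 2                                     ≡⟨ ℕₚ.*-comm (f zero) 2 ⟩
  f zero + (f zero + 0)                          ≡⟨ cong (f zero +_) (ℕₚ.+-identityʳ (f zero)) ⟩
  f zero + f zero                                ∎
  where open ≡-Reasoning
pairing-pair f zero    (suc j) = cong₂ _+_ (ℕₚ.*-identityʳ (f zero)) (pairing-unit (f ∘ suc) j)
pairing-pair f (suc i) zero    =
  trans (cong₂ _+_ (ℕₚ.*-identityʳ (f zero)) (pairing-unit (f ∘ suc) i)) (ℕₚ.+-comm (f zero) (f (suc i)))
pairing-pair f (suc i) (suc j) = cong₂ _+_ (ℕₚ.*-zeroʳ (f zero)) (pairing-pair (f ∘ suc) i j)

S-cons₀ : ∀ {n r} {x : Vec ℕ n} → S n r x → S (suc n) r (0 ∷ x)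
S-cons₀ (bin , c) = (λ { zero → inj₁ refl ; (suc i) → bin i }) , c

S-cons₁ : ∀ {n r} {x : Vec ℕ n} → S n r x → S (suc n) (suc r) (1 ∷ x)
S-cons₁ (bin , c) = (λ { zero → inj₂ refl ; (suc i) → bin i }) , cong suc c

zeros∈S₀ : ∀ n → S n 0 (replicate n 0)
zeros∈S₀ zero    = (λ ()) , refl
zeros∈S₀ (suc n) = S-cons₀ (zeros∈S₀ n)

unit∈S₁ : ∀ {n} (j : Fin n) → S n 1 (unit j)
unit∈S₁ {suc n} zero    = S-cons₁ (zeros∈S₀ n)
unit∈S₁         (suc j) = S-cons₀ (unit∈S₁ j)

pair∈S₂ : ∀ {n} {i j : Fin n} → i ≢ j → S n 2 (pair i j)
pair∈S₂ {i = zero}  {zero}  i≢j = ⊥-elim (i≢j refl)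
pair∈S₂ {i = zero}  {suc j} _   = S-cons₁ (unit∈S₁ j)
pair∈S₂ {i = suc i} {zero}  _   = S-cons₁ (unit∈S₁ i)
pair∈S₂ {i = suc i} {suc j} i≢j = S-cons₀ (pair∈S₂ (i≢j ∘ cong suc))

S₀⇒zeros : ∀ {n} (x : Vec ℕ n) → S n 0 x → x ≡ replicate n 0
S₀⇒zeros []      _         = refl
S₀⇒zeros (_ ∷ x) (bin , c) with bin zero
... | inj₁ refl = cong (0 ∷_) (S₀⇒zeros x (bin ∘ suc , c))
S₀⇒zeros (_ ∷ x) (bin , ()) | inj₂ refl

S₁⇒unit : ∀ {n} (x : Vec ℕ n) → S n 1 x → ∃ λ j → x ≡ unit j
S₁⇒unit (_ ∷ x) (bin , c) with bin zero
... | inj₁ refl = let j , x≡ = S₁⇒unit x (bin ∘ suc , c) in suc j , cong (0 ∷_) x≡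
... | inj₂ refl = zero , cong (1 ∷_) (S₀⇒zeros x (bin ∘ suc , ℕₚ.suc-injective c))

S₂⇒pair : ∀ {n} (x : Vec ℕ n) → S n 2 x → ∃₂ λ i j → i ≢ j × x ≡ pair i j
S₂⇒pair (_ ∷ x) (bin , c) with bin zero
... | inj₁ refl = let i , j , i≢j , x≡ = S₂⇒pair x (bin ∘ suc , c) in
  suc i , suc j , i≢j ∘ Finₚ.suc-injective , cong (0 ∷_) x≡
... | inj₂ refl = let j , x≡ = S₁⇒unit x (bin ∘ suc , ℕₚ.suc-injective c) in
  zero , suc j , (λ ()) , cong (1 ∷_) x≡

bit≤1 : ∀ n i → bit n i ≤ 1
bit≤1 n i = ℕₚ.≤-pred (m%n<n (_/_ n (2 ^ i) {{2^d-nonzero i}}) 2)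

bit-zero : ∀ n → bit n 0 ≡ n % 2
bit-zero n = cong (_% 2) (n/1≡n n)

bit-suc : ∀ n i → bit n (suc i) ≡ bit (n / 2) i
bit-suc n i = cong (_% 2) (sym (m/n/o≡m/[n*o] n 2 (2 ^ i)))
  where instance
    _ = 2^d-nonzero i
    _ = 2^d-nonzero (suc i)

encode : ∀ {d} → Vec ℕ d → ℕ
encode []       = 0
encode (a ∷ as) = a + encode as * 2

encode-< : ∀ {d} (a : Vec ℕ d) → IsBinary a → encode a < 2 ^ d
encode-< []       _   = s≤s z≤n
encode-< {suc d} (a ∷ as) bin = begin-strict
  a + encode as * 2       <⟨ s≤s (ℕₚ.+-monoˡ-≤ (encode as * 2) (a≤1 (bin zero))) ⟩
  suc (encode as) * 2     ≤⟨ ℕₚ.*-monoˡ-≤ 2 (encode-< as (bin ∘ suc)) ⟩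
  2 ^ d * 2               ≡⟨ ℕₚ.*-comm (2 ^ d) 2 ⟩
  2 ^ suc d               ∎
  where
  open ℕₚ.≤-Reasoning
  a≤1 : ∀ {a} → a ≡ 0 ⊎ a ≡ 1 → a ≤ 1
  a≤1 (inj₁ refl) = z≤n
  a≤1 (inj₂ refl) = s≤s z≤n

digit-%2 : ∀ {a} e → a ≡ 0 ⊎ a ≡ 1 → (a + e * 2) % 2 ≡ a
digit-%2 e (inj₁ refl) = m*n%n≡0 e 2
digit-%2 e (inj₂ refl) = [m+kn]%n≡m%n 1 e 2

digit-/2 : ∀ {a} e → a ≡ 0 ⊎ a ≡ 1 → (a + e * 2) / 2 ≡ e
digit-/2 e (inj₁ refl) = m*n/n≡m e 2
digit-/2 e (inj₂ refl) =
  trans (+-distrib-/ 1 (e * 2) (subst (λ r → 1 + r < 2) (sym (m*n%n≡0 e 2)) ℕₚ.≤-refl)) (m*n/n≡m e 2)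

bit-encode : ∀ {d} (a : Vec ℕ d) → IsBinary a → (i : Fin d) → bit (encode a) (toℕ i) ≡ lookup a i
bit-encode (a ∷ as) bin zero    = trans (bit-zero (a + encode as * 2)) (digit-%2 (encode as) (bin zero))
bit-encode (a ∷ as) bin (suc i) = begin
  bit (a + encode as * 2) (suc (toℕ i))   ≡⟨ bit-suc (a + encode as * 2) (toℕ i) ⟩
  bit ((a + encode as * 2) / 2) (toℕ i)   ≡⟨ cong (λ n → bit n (toℕ i)) (digit-/2 (encode as) (bin zero)) ⟩
  bit (encode as) (toℕ i)                 ≡⟨ bit-encode as (bin ∘ suc) i ⟩
  lookup as i                             ∎
  where open ≡-Reasoning

bits-differ : ∀ d {m n} → m < 2 ^ d → n < 2 ^ d → m ≢ n → ∃ λ (i : Fin d) → bit m (toℕ i) ≢ bit n (toℕ i)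
bits-differ zero    {zero} {zero} _ _ m≢n = ⊥-elim (m≢n refl)
bits-differ zero    {suc _} (s≤s ()) _
bits-differ zero    {_} {suc _} _ (s≤s ())
bits-differ (suc d) {m} {n} m< n< m≢n with m % 2 ℕ.≟ n % 2
... | no  low≢ = zero , λ eq → low≢ (trans (sym (bit-zero m)) (trans eq (bit-zero n)))
... | yes low≡ = let i , high≢ = bits-differ d (halve m<) (halve n<) high-differ in
  suc i , λ eq → high≢ (trans (sym (bit-suc m (toℕ i))) (trans eq (bit-suc n (toℕ i))))
  where
  halve : ∀ {k} → k < 2 ^ suc d → k / 2 < 2 ^ d
  halve {k} k< = m<n*o⇒m/o<n {k} {2 ^ d} {2} (subst (k <_) (ℕₚ.*-comm 2 (2 ^ d)) k<)
  high-differ : m / 2 ≢ n / 2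
  high-differ eq = m≢n (begin
    m                  ≡⟨ m≡m%n+[m/n]*n m 2 ⟩
    m % 2 + m / 2 * 2  ≡⟨ cong₂ (λ r q → r + q * 2) low≡ eq ⟩
    n % 2 + n / 2 * 2  ≡⟨ sym (m≡m%n+[m/n]*n n 2) ⟩
    n                  ∎)
    where open ≡-Reasoning

module _ {d : ℕ} where

  private
    col< : (j : Fin (1 * 2 ^ d)) → toℕ j < 2 ^ d
    col< j = subst (toℕ j <_) (ℕₚ.*-identityˡ (2 ^ d)) (Finₚ.toℕ<n j)

  W¹-bit : ∀ i j → W 1 d i j ≡ bit (toℕ j) (toℕ i)
  W¹-bit i j = cong (λ n → bit n (toℕ i)) (m<n⇒m%n≡m {{2^d-nonzero d}} (col< j))

  W¹≤1 : ∀ i j → W 1 d i j ≤ 1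
  W¹≤1 i j = bit≤1 _ (toℕ i)

  W¹-columns-differ : ∀ {j₁ j₂} → j₁ ≢ j₂ → ∃ λ i → W 1 d i j₁ ≢ W 1 d i j₂
  W¹-columns-differ {j₁} {j₂} j₁≢j₂ =
    let i , bits≢ = bits-differ d (col< j₁) (col< j₂) (j₁≢j₂ ∘ Finₚ.toℕ-injective) in
    i , λ eq → bits≢ (trans (sym (W¹-bit i j₁)) (trans eq (W¹-bit i j₂)))

  W¹-column : ∀ (a : Vec ℕ d) → IsBinary a → ∃ λ j → ∀ i → W 1 d i j ≡ lookup a i
  W¹-column a bin = fromℕ< encode<  , λ i → begin
    W 1 d i (fromℕ< encode<)            ≡⟨ W¹-bit i _ ⟩
    bit (toℕ (fromℕ< encode<)) (toℕ i)  ≡⟨ cong (λ n → bit n (toℕ i)) (Finₚ.toℕ-fromℕ< encode<) ⟩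
    bit (encode a) (toℕ i)              ≡⟨ bit-encode a bin i ⟩
    lookup a i                          ∎
    where
    open ≡-Reasoning
    encode< : encode a < 1 * 2 ^ d
    encode< = subst (encode a <_) (sym (ℕₚ.*-identityˡ (2 ^ d))) (encode-< a bin)

count≢0⇒lookup : ∀ {n} a (v : Vec ℕ n) → count a v ≢ 0 → ∃ λ i → lookup v i ≡ a
count≢0⇒lookup a []       c≢0 = ⊥-elim (c≢0 refl)
count≢0⇒lookup a (x ∷ xs) c≢0 with x ℕ.≟ a
... | yes x≡a = zero , x≡a
... | no  _   = let i , xsᵢ≡a = count≢0⇒lookup a xs c≢0 in suc i , xsᵢ≡a

lookup⇒count≢0 : ∀ {n} a (v : Vec ℕ n) i → lookup v i ≡ a → count a v ≢ 0
lookup⇒count≢0 a (x ∷ xs) i       vᵢ≡a with x ℕ.≟ a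
... | yes _ = λ ()
lookup⇒count≢0 a (x ∷ xs) zero    x≡a  | no x≢a = ⊥-elim (x≢a x≡a)
lookup⇒count≢0 a (x ∷ xs) (suc i) vᵢ≡a | no _   = lookup⇒count≢0 a xs i vᵢ≡a

count-unique : ∀ {n} a (v : Vec ℕ n) → count a v ≡ 1 → ∀ {i k} → lookup v i ≡ a → lookup v k ≡ a → i ≡ k
count-unique a (x ∷ xs) c {i} {k} vᵢ≡a vₖ≡a with x ℕ.≟ a
count-unique a (x ∷ xs) c {zero}  {zero}  _    _    | yes _ = refl
count-unique a (x ∷ xs) c {zero}  {suc k} _    vₖ≡a | yes _ = ⊥-elim (lookup⇒count≢0 a xs k vₖ≡a (ℕₚ.suc-injective c))
count-unique a (x ∷ xs) c {suc i} {_}     vᵢ≡a _    | yes _ = ⊥-elim (lookup⇒count≢0 a xs i vᵢ≡a (ℕₚ.suc-injective c))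
count-unique a (x ∷ xs) c {zero}  {_}     x≡a  _    | no x≢a = ⊥-elim (x≢a x≡a)
count-unique a (x ∷ xs) c {suc i} {zero}  _    x≡a  | no x≢a = ⊥-elim (x≢a x≡a)
count-unique a (x ∷ xs) c {suc i} {suc k} vᵢ≡a vₖ≡a | no _  = cong suc (count-unique a xs c vᵢ≡a vₖ≡a)

count≥2⇒two-positions : ∀ {n} a (v : Vec ℕ n) {m} → count a v ≡ suc (suc m) →
  ∃₂ λ i k → i ≢ k × lookup v i ≡ a × lookup v k ≡ a
count≥2⇒two-positions a (x ∷ xs) c with x ℕ.≟ a
... | yes x≡a = let k , xsₖ≡a = count≢0⇒lookup a xs (λ c′ → ℕₚ.1+n≢0 (trans (sym (ℕₚ.suc-injective c)) c′)) in
  zero , suc k , (λ ()) , x≡a , xsₖ≡a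
... | no _ = let i , k , i≢k , xsᵢ≡a , xsₖ≡a = count≥2⇒two-positions a xs c in
  suc i , suc k , i≢k ∘ Finₚ.suc-injective , xsᵢ≡a , xsₖ≡a

distinct-bits-sum : ∀ {a b} → a ≤ 1 → b ≤ 1 → a ≢ b → a + b ≡ 1
distinct-bits-sum {zero}  {zero}  _         _         a≢b = ⊥-elim (a≢b refl)
distinct-bits-sum {zero}  {suc zero} _      _         _   = refl
distinct-bits-sum {suc zero} {zero}  _      _         _   = refl
distinct-bits-sum {suc zero} {suc zero} _   _         a≢b = ⊥-elim (a≢b refl)
distinct-bits-sum {suc (suc _)} (s≤s ()) _ _
distinct-bits-sum {b = suc (suc _)} _ (s≤s ()) _

≤1⇒binary : ∀ {a} → a ≤ 1 → a ≡ 0 ⊎ a ≡ 1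
≤1⇒binary z≤n       = inj₁ refl
≤1⇒binary (s≤s z≤n) = inj₂ refl

⊓1+∸1 : ∀ y → y ⊓ 1 + (y ∸ 1) ≡ y
⊓1+∸1 zero    = refl
⊓1+∸1 (suc y) = cong (λ z → suc (z + y)) (ℕₚ.⊓-zeroʳ y)

module _ {d : ℕ} where

  SumOfDistinctColumns : Vec ℕ d → Set
  SumOfDistinctColumns v = ∃₂ λ j₁ j₂ → j₁ ≢ j₂ × ∀ i → lookup v i ≡ W 1 d i j₁ + W 1 d i j₂

  Image⇔SumOfDistinctColumns : ∀ v → Image 1 d 2 v ⇔ SumOfDistinctColumns v
  Image⇔SumOfDistinctColumns v = mk⇔ to from
    where
    W·pair : ∀ j₁ j₂ → _·ᵥ_ {1} (W 1 d) (pair j₁ j₂) ≡ tabulate (λ i → W 1 d i j₁ + W 1 d i j₂)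
    W·pair j₁ j₂ = Vecₚ.tabulate-cong (λ i → pairing-pair (W 1 d i) j₁ j₂)
    to : Image 1 d 2 v → SumOfDistinctColumns v
    to (x , x∈S₂ , Wx≡v) with S₂⇒pair x x∈S₂
    ... | j₁ , j₂ , j₁≢j₂ , refl = j₁ , j₂ , j₁≢j₂ , λ i →
      trans (cong (λ u → lookup u i) (sym Wx≡v))
            (trans (cong (λ u → lookup u i) (W·pair j₁ j₂)) (Vecₚ.lookup∘tabulate _ i))
    from : SumOfDistinctColumns v → Image 1 d 2 v
    from (j₁ , j₂ , j₁≢j₂ , v≡) = pair j₁ j₂ , pair∈S₂ j₁≢j₂ ,
      trans (W·pair j₁ j₂) (trans (Vecₚ.tabulate-cong (sym ∘ v≡)) (Vecₚ.tabulate∘lookup v))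

  SumOfDistinctColumns⇒V∖V₀ : ∀ v → SumOfDistinctColumns v → InV v × ¬ InVi 0 v
  SumOfDistinctColumns⇒V∖V₀ v (j₁ , j₂ , j₁≢j₂ , v≡) = entries≤2 , λ (_ , no-ones) → lookup⇒count≢0 1 v i vᵢ≡1 no-ones
    where
    entries≤2 : InV v
    entries≤2 i = subst (_≤ 2) (sym (v≡ i)) (ℕₚ.+-mono-≤ (W¹≤1 i j₁) (W¹≤1 i j₂))
    differ = W¹-columns-differ {d} j₁≢j₂
    i = proj₁ differ
    vᵢ≡1 : lookup v i ≡ 1
    vᵢ≡1 = trans (v≡ i) (distinct-bits-sum (W¹≤1 i j₁) (W¹≤1 i j₂) (proj₂ differ))

  V∖V₀⇒SumOfDistinctColumns : ∀ v → InV v → ¬ InVi 0 v → SumOfDistinctColumns v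
  V∖V₀⇒SumOfDistinctColumns v v∈V v∉V₀ = j₁ , j₂ , j₁≢j₂ , v≡
    where
    high = map (_⊓ 1) v
    low  = map (_∸ 1) v
    high-binary : IsBinary high
    high-binary i = subst (λ y → y ≡ 0 ⊎ y ≡ 1) (sym (Vecₚ.lookup-map i (_⊓ 1) v)) (≤1⇒binary (ℕₚ.m⊓n≤n (lookup v i) 1))
    low-binary : IsBinary low
    low-binary i = subst (λ y → y ≡ 0 ⊎ y ≡ 1) (sym (Vecₚ.lookup-map i (_∸ 1) v)) (≤1⇒binary (ℕₚ.∸-monoˡ-≤ 1 (v∈V i)))
    j₁ = proj₁ (W¹-column high high-binary)
    j₂ = proj₁ (W¹-column low low-binary)
    W-high : ∀ i → W 1 d i j₁ ≡ lookup v i ⊓ 1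
    W-high i = trans (proj₂ (W¹-column high high-binary) i) (Vecₚ.lookup-map i (_⊓ 1) v)
    W-low : ∀ i → W 1 d i j₂ ≡ lookup v i ∸ 1
    W-low i = trans (proj₂ (W¹-column low low-binary) i) (Vecₚ.lookup-map i (_∸ 1) v)
    v≡ : ∀ i → lookup v i ≡ W 1 d i j₁ + W 1 d i j₂
    v≡ i = sym (trans (cong₂ _+_ (W-high i) (W-low i)) (⊓1+∸1 (lookup v i)))
    j₁≢j₂ : j₁ ≢ j₂
    j₁≢j₂ j₁≡j₂ = ℕₚ.1+n≢0 (subst (λ y → y ⊓ 1 ≡ y ∸ 1) vᵢ≡1 highᵢ≡lowᵢ)
      where
      one = count≢0⇒lookup 1 v (λ no-ones → v∉V₀ (v∈V , no-ones))
      i = proj₁ one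
      vᵢ≡1 = proj₂ one
      highᵢ≡lowᵢ = trans (sym (W-high i)) (trans (cong (W 1 d i) j₁≡j₂) (W-low i))

  Image⇔V∖V₀ : ∀ v → Image 1 d 2 v ⇔ (InV v × ¬ InVi 0 v)
  Image⇔V∖V₀ v = mk⇔
    (SumOfDistinctColumns⇒V∖V₀ v ∘ Equivalence.to (Image⇔SumOfDistinctColumns v))
    (λ (v∈V , v∉V₀) → Equivalence.from (Image⇔SumOfDistinctColumns v) (V∖V₀⇒SumOfDistinctColumns v v∈V v∉V₀))

toℚ-injective : ∀ {m n} → toℚ m ≡ toℚ n → m ≡ n
toℚ-injective {m} {n} eq = ℤ.+-injective (trans (sym (↥toℚ m)) (trans (cong ℚ.↥_ eq) (↥toℚ n)))
  where
  ↥toℚ : ∀ k → ℚ.↥ (toℚ k) ≡ ℤ.+ k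
  ↥toℚ k = cong ℚ.↥_ (ℚₚ.normalize-coprime {k} {0} (Coprimality.sym (Coprimality.1-coprimeTo k)))

embed-injective : ∀ {d} {x y : Vec ℕ d} → embed x ≡ embed y → x ≡ y
embed-injective {x = []}    {[]}    _  = refl
embed-injective {x = _ ∷ _} {_ ∷ _} eq =
  cong₂ _∷_ (toℚ-injective (Vecₚ.∷-injectiveˡ eq)) (embed-injective (Vecₚ.∷-injectiveʳ eq))

centred : ℕ → ℚ
centred b = toℚ b ℚ.- 1ℚ

centred-bound : ∀ {a b} → a ≤ 2 → b ≤ 2 → centred b ℚ.* toℚ a ℚ.≤ centred b ℚ.* toℚ b
centred-bound z≤n                 z≤n                 = ℚₚ.≤ᵇ⇒≤ tt
centred-bound z≤n                 (s≤s z≤n)           = ℚₚ.≤ᵇ⇒≤ tt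
centred-bound z≤n                 (s≤s (s≤s z≤n))     = ℚₚ.≤ᵇ⇒≤ tt
centred-bound (s≤s z≤n)           z≤n                 = ℚₚ.≤ᵇ⇒≤ tt
centred-bound (s≤s z≤n)           (s≤s z≤n)           = ℚₚ.≤ᵇ⇒≤ tt
centred-bound (s≤s z≤n)           (s≤s (s≤s z≤n))     = ℚₚ.≤ᵇ⇒≤ tt
centred-bound (s≤s (s≤s z≤n))     z≤n                 = ℚₚ.≤ᵇ⇒≤ tt
centred-bound (s≤s (s≤s z≤n))     (s≤s z≤n)           = ℚₚ.≤ᵇ⇒≤ tt
centred-bound (s≤s (s≤s z≤n))     (s≤s (s≤s z≤n))     = ℚₚ.≤ᵇ⇒≤ tt

centred-tight : ∀ {a b} → a ≤ 2 → b ≤ 2 → b ≢ 1 → centred b ℚ.* toℚ a ≡ centred b ℚ.* toℚ b → a ≡ b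
centred-tight z≤n                 z≤n                 _   _  = refl
centred-tight (s≤s (s≤s z≤n))     (s≤s (s≤s z≤n))     _   _  = refl
centred-tight _                   (s≤s z≤n)           b≢1 _  = ⊥-elim (b≢1 refl)
centred-tight (s≤s z≤n)           z≤n                 _   ()
centred-tight (s≤s (s≤s z≤n))     z≤n                 _   ()
centred-tight z≤n                 (s≤s (s≤s z≤n))     _   ()
centred-tight (s≤s z≤n)           (s≤s (s≤s z≤n))     _   ()

⟨centred⟩-bound : ∀ {d} (u v : Vec ℕ d) → InV u → InV v →
  ⟨ map centred v ∣ embed u ⟩ ℚ.≤ ⟨ map centred v ∣ embed v ⟩
⟨centred⟩-bound []       []       _   _   = ℚₚ.≤-refl
⟨centred⟩-bound (a ∷ u) (b ∷ v) u∈V v∈V =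
  ℚₚ.+-mono-≤ (centred-bound (u∈V zero) (v∈V zero)) (⟨centred⟩-bound u v (u∈V ∘ suc) (v∈V ∘ suc))

⟨centred⟩-tight : ∀ {d} (u v : Vec ℕ d) → InV u → InV v →
  ⟨ map centred v ∣ embed u ⟩ ≡ ⟨ map centred v ∣ embed v ⟩ → ∀ i → lookup v i ≢ 1 → lookup u i ≡ lookup v i
⟨centred⟩-tight (a ∷ u) (b ∷ v) u∈V v∈V eq i vᵢ≢1 with +-≤-tight
    (centred-bound (u∈V zero) (v∈V zero)) (⟨centred⟩-bound u v (u∈V ∘ suc) (v∈V ∘ suc)) eq
⟨centred⟩-tight (a ∷ u) (b ∷ v) u∈V v∈V eq zero    b≢1  | head≡ , _ = centred-tight (u∈V zero) (v∈V zero) b≢1 head≡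
⟨centred⟩-tight (a ∷ u) (b ∷ v) u∈V v∈V eq (suc i) vᵢ≢1 | _ , tail≡ =
  ⟨centred⟩-tight u v (u∈V ∘ suc) (v∈V ∘ suc) tail≡ i vᵢ≢1

lookup-affine : ∀ {d} s t (x y : Vec ℕ d) j →
  lookup ((s ∙ᵥ embed x) +ᵥ (t ∙ᵥ embed y)) j ≡ s ℚ.* toℚ (lookup x j) ℚ.+ t ℚ.* toℚ (lookup y j)
lookup-affine s t x y j = trans (Vecₚ.lookup-zipWith ℚ._+_ j (s ∙ᵥ embed x) (t ∙ᵥ embed y))
  (cong₂ ℚ._+_ (trans (Vecₚ.lookup-map j (s ℚ.*_) (embed x)) (cong (s ℚ.*_) (Vecₚ.lookup-map j toℚ x)))
               (trans (Vecₚ.lookup-map j (t ℚ.*_) (embed y)) (cong (t ℚ.*_) (Vecₚ.lookup-map j toℚ y))))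

midpoint-of-updates : ∀ {d} (u : Vec ℕ d) i → lookup u i ≡ 1 →
  embed u ≡ (½ ∙ᵥ embed (u [ i ]≔ 0)) +ᵥ ((1ℚ ℚ.- ½) ∙ᵥ embed (u [ i ]≔ 2))
midpoint-of-updates u i uᵢ≡1 = Pointwise-≡⇒≡ (ext λ j →
  trans (Vecₚ.lookup-map j toℚ u) (trans (entry j) (sym (lookup-affine ½ (1ℚ ℚ.- ½) (u [ i ]≔ 0) (u [ i ]≔ 2) j))))
  where
  entry : ∀ j → toℚ (lookup u j) ≡ ½ ℚ.* toℚ (lookup (u [ i ]≔ 0) j) ℚ.+ (1ℚ ℚ.- ½) ℚ.* toℚ (lookup (u [ i ]≔ 2) j)
  entry j with j Finₚ.≟ i
  ... | yes refl rewrite uᵢ≡1 | Vecₚ.lookup∘update j u 0 | Vecₚ.lookup∘update j u 2 = refl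
  ... | no j≢i   rewrite Vecₚ.lookup∘update′ j≢i u 0 | Vecₚ.lookup∘update′ j≢i u 2 =
    trans (sym (ℚₚ.*-identityˡ (toℚ (lookup u j)))) (ℚₚ.*-distribʳ-+ (toℚ (lookup u j)) ½ (1ℚ ℚ.- ½))

module _ {d : ℕ} where

  private
    image⇒V : ∀ {u : Vec ℕ d} → Image 1 d 2 u → InV u × ¬ InVi 0 u
    image⇒V {u} = Equivalence.to (Image⇔V∖V₀ u)

    V∖V₀⇒image : ∀ (u : Vec ℕ d) → InV u → ¬ InVi 0 u → Image 1 d 2 u
    V∖V₀⇒image u u∈V u∉V₀ = Equivalence.from (Image⇔V∖V₀ u) (u∈V , u∉V₀)

  V₁⇒vertex : ∀ v → InVi 1 v → IsVertex (Conv (ImageQ 1 d 2)) (embed v)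
  V₁⇒vertex v (v∈V , single-one) = Exposed.exposed⇒vertex (map centred v) (embed v) bound unique v∈P
    where
    v∈P : ImageQ 1 d 2 (embed v)
    v∈P = v , V∖V₀⇒image v v∈V (λ (_ , no-ones) → ℕₚ.1+n≢0 (trans (sym single-one) no-ones)) , refl
    bound : ∀ {p} → ImageQ 1 d 2 p → ⟨ map centred v ∣ p ⟩ ℚ.≤ ⟨ map centred v ∣ embed v ⟩
    bound (u , u∈I , refl) = ⟨centred⟩-bound u v (proj₁ (image⇒V u∈I)) v∈V
    -- u agrees with v off the unique 1 of v, and u has a 1 somewhere, which must be there.
    unique : ∀ {p} → ImageQ 1 d 2 p → ⟨ map centred v ∣ p ⟩ ≡ ⟨ map centred v ∣ embed v ⟩ → p ≡ embed v
    unique (u , u∈I , refl) eq = cong embed (Pointwise-≡⇒≡ (ext agree))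
      where
      u∈V = proj₁ (image⇒V u∈I)
      off-one = ⟨centred⟩-tight u v u∈V v∈V eq
      one-of-u = count≢0⇒lookup 1 u (λ no-ones → proj₂ (image⇒V u∈I) (u∈V , no-ones))
      k = proj₁ one-of-u
      uₖ≡1 = proj₂ one-of-u
      vₖ≡1 : lookup v k ≡ 1
      vₖ≡1 with lookup v k ℕ.≟ 1
      ... | yes vₖ≡1 = vₖ≡1
      ... | no  vₖ≢1 = ⊥-elim (vₖ≢1 (trans (sym (off-one k vₖ≢1)) uₖ≡1))
      agree : ∀ i → lookup u i ≡ lookup v i
      agree i with lookup v i ℕ.≟ 1
      ... | no  vᵢ≢1 = off-one i vᵢ≢1
      ... | yes vᵢ≡1 rewrite count-unique 1 v single-one vᵢ≡1 vₖ≡1 = trans uₖ≡1 (sym vₖ≡1)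

  update∈image : ∀ (u : Vec ℕ d) → InV u → ∀ {i k} → i ≢ k → lookup u k ≡ 1 →
    ∀ {y} → y ≤ 2 → Image 1 d 2 (u [ i ]≔ y)
  update∈image u u∈V {i} {k} i≢k uₖ≡1 {y} y≤2 = V∖V₀⇒image (u [ i ]≔ y) updated∈V updated∉V₀
    where
    updated∈V : InV (u [ i ]≔ y)
    updated∈V j with j Finₚ.≟ i
    ... | yes refl = subst (_≤ 2) (sym (Vecₚ.lookup∘update j u y)) y≤2
    ... | no  j≢i  = subst (_≤ 2) (sym (Vecₚ.lookup∘update′ j≢i u y)) (u∈V j)
    updated∉V₀ : ¬ InVi 0 (u [ i ]≔ y)
    updated∉V₀ (_ , no-ones) =
      lookup⇒count≢0 1 (u [ i ]≔ y) k (trans (Vecₚ.lookup∘update′ (i≢k ∘ sym) u y) uₖ≡1) no-ones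

  two-ones⇒¬extreme : ∀ (u : Vec ℕ d) → InV u → ∀ {i k} → i ≢ k → lookup u i ≡ 1 → lookup u k ≡ 1 →
    ¬ Extreme (Conv (ImageQ 1 d 2)) (embed u)
  two-ones⇒¬extreme u u∈V {i} {k} i≢k uᵢ≡1 uₖ≡1 extreme = 0≢1 (begin
    toℚ 0                          ≡⟨ cong toℚ (sym (Vecₚ.lookup∘update i u 0)) ⟩
    toℚ (lookup (u [ i ]≔ 0) i)    ≡⟨ sym (Vecₚ.lookup-map i toℚ (u [ i ]≔ 0)) ⟩
    lookup (embed (u [ i ]≔ 0)) i  ≡⟨ cong (λ x → lookup x i) lowered≡u ⟩
    lookup (embed u) i             ≡⟨ Vecₚ.lookup-map i toℚ u ⟩
    toℚ (lookup u i)               ≡⟨ cong toℚ uᵢ≡1 ⟩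
    toℚ 1                          ∎)
    where
    open ≡-Reasoning
    0≢1 : toℚ 0 ≢ toℚ 1
    0≢1 ()
    updated∈P : ∀ {y} → y ≤ 2 → Conv (ImageQ 1 d 2) (embed (u [ i ]≔ y))
    updated∈P {y} y≤2 = Conv-singleton (u [ i ]≔ y , update∈image u u∈V i≢k uₖ≡1 y≤2 , refl)
    lowered≡u : embed (u [ i ]≔ 0) ≡ embed u
    lowered≡u = proj₁ (extreme (embed (u [ i ]≔ 0)) (embed (u [ i ]≔ 2)) ½ (updated∈P z≤n) (updated∈P (s≤s (s≤s z≤n)))
                  (ℚₚ.positive⁻¹ ½) (ℚ.*<* (ℤ.+<+ (s≤s (s≤s z≤n)))) (midpoint-of-updates u i uᵢ≡1))

  vertex⇒V₁ : ∀ w → IsVertex (Conv (ImageQ 1 d 2)) w → ∃ λ v → InVi 1 v × embed v ≡ w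
  vertex⇒V₁ w vertex with vertex∈ vertex
  ... | u , u∈I , refl = u , (u∈V , single-one) , refl
    where
    u∈V = proj₁ (image⇒V u∈I)
    single-one : count 1 u ≡ 1
    single-one with count 1 u in eq
    ... | zero        = ⊥-elim (proj₂ (image⇒V u∈I) (u∈V , eq))
    ... | suc zero    = refl
    ... | suc (suc m) = let i , k , i≢k , uᵢ≡1 , uₖ≡1 = count≥2⇒two-positions 1 u eq in
      ⊥-elim (two-ones⇒¬extreme u u∈V i≢k uᵢ≡1 uₖ≡1 (proj₂ vertex))

  vertex⇔V₁ : ∀ w → IsVertex (Conv (ImageQ 1 d 2)) w ⇔ (∃ λ v → InVi 1 v × embed v ≡ w)
  vertex⇔V₁ w = mk⇔ (vertex⇒V₁ w) λ { (v , v∈V₁ , refl) → V₁⇒vertex v v∈V₁ }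

V₀-list : ∀ d → List (Vec ℕ d)
V₀-list zero    = [] ∷ []
V₀-list (suc d) = List.map (0 ∷_) (V₀-list d) ++ List.map (2 ∷_) (V₀-list d)

V₁-list : ∀ d → List (Vec ℕ d)
V₁-list zero    = []
V₁-list (suc d) = List.map (1 ∷_) (V₀-list d) ++ (List.map (0 ∷_) (V₁-list d) ++ List.map (2 ∷_) (V₁-list d))

private
  length-prefixed : ∀ {d} a (xs : List (Vec ℕ d)) (ys : List (Vec ℕ (suc d))) →
    length (List.map (a ∷_) xs ++ ys) ≡ length xs + length ys
  length-prefixed a xs ys =
    trans (Listₚ.length-++ (List.map (a ∷_) xs)) (cong (_+ length ys) (Listₚ.length-map (a ∷_) xs))

  Unique-map-∷ : ∀ {d} a {xs : List (Vec ℕ d)} → Unique xs → Unique (List.map (a ∷_) xs)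
  Unique-map-∷ a = Uniqueₚ.map⁺ (λ eq → Vecₚ.∷-injectiveʳ eq)

  disjoint-heads : ∀ {d a b} {xs ys : List (Vec ℕ d)} → a ≢ b →
    ∀ {v} → ¬ (v ∈ List.map (a ∷_) xs × v ∈ List.map (b ∷_) ys)
  disjoint-heads {a = a} {b} a≢b (v∈as , v∈bs) with ∈-map⁻ (a ∷_) v∈as | ∈-map⁻ (b ∷_) v∈bs
  ... | _ , _ , refl | _ , _ , eq = a≢b (Vecₚ.∷-injectiveˡ eq)

Unique-V₀-list : ∀ d → Unique (V₀-list d)
Unique-V₀-list zero    = [] ∷ []
Unique-V₀-list (suc d) =
  Uniqueₚ.++⁺ (Unique-map-∷ 0 (Unique-V₀-list d)) (Unique-map-∷ 2 (Unique-V₀-list d)) (disjoint-heads λ ())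

Unique-V₁-list : ∀ d → Unique (V₁-list d)
Unique-V₁-list zero    = []
Unique-V₁-list (suc d) = Uniqueₚ.++⁺ (Unique-map-∷ 1 (Unique-V₀-list d))
  (Uniqueₚ.++⁺ (Unique-map-∷ 0 (Unique-V₁-list d)) (Unique-map-∷ 2 (Unique-V₁-list d)) (disjoint-heads λ ()))
  λ (v∈1s , v∈rest) → case-rest v∈1s (∈-++⁻ (List.map (0 ∷_) (V₁-list d)) v∈rest)
  where
  case-rest : ∀ {v} → v ∈ List.map (1 ∷_) (V₀-list d) → _ → _
  case-rest v∈1s (inj₁ v∈0s) = disjoint-heads (λ ()) (v∈1s , v∈0s)
  case-rest v∈1s (inj₂ v∈2s) = disjoint-heads (λ ()) (v∈1s , v∈2s)

length-V₀-list : ∀ d → length (V₀-list d) ≡ 2 ^ d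
length-V₀-list zero    = refl
length-V₀-list (suc d) = begin
  length (V₀-list (suc d))
    ≡⟨ length-prefixed 0 (V₀-list d) _ ⟩
  length (V₀-list d) + length (List.map (2 ∷_) (V₀-list d))
    ≡⟨ cong (length (V₀-list d) +_) (Listₚ.length-map (2 ∷_) (V₀-list d)) ⟩
  length (V₀-list d) + length (V₀-list d)
    ≡⟨ cong (λ n → n + n) (length-V₀-list d) ⟩
  2 ^ d + 2 ^ d
    ≡⟨ cong (2 ^ d +_) (sym (ℕₚ.+-identityʳ (2 ^ d))) ⟩
  2 ^ suc d
    ∎
  where open ≡-Reasoning

length-V₁-list : ∀ d → length (V₁-list d) ≡ d * 2 ^ (d ∸ 1)
length-V₁-list zero    = refl
length-V₁-list (suc d) = begin
  length (V₁-list (suc d))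
    ≡⟨ length-prefixed 1 (V₀-list d) _ ⟩
  length (V₀-list d) + length (List.map (0 ∷_) (V₁-list d) ++ List.map (2 ∷_) (V₁-list d))
    ≡⟨ cong (length (V₀-list d) +_) (trans (length-prefixed 0 (V₁-list d) _)
                                           (cong (length (V₁-list d) +_) (Listₚ.length-map (2 ∷_) (V₁-list d)))) ⟩
  length (V₀-list d) + (length (V₁-list d) + length (V₁-list d))
    ≡⟨ cong₂ _+_ (length-V₀-list d) (cong (λ n → n + n) (length-V₁-list d)) ⟩
  2 ^ d + (d * 2 ^ (d ∸ 1) + d * 2 ^ (d ∸ 1))
    ≡⟨ cong (2 ^ d +_) (double d) ⟩
  2 ^ d + d * 2 ^ d
    ∎
  where
  open ≡-Reasoning
  double : ∀ d → d * 2 ^ (d ∸ 1) + d * 2 ^ (d ∸ 1) ≡ d * 2 ^ d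
  double zero    = refl
  double (suc e) = trans (sym (ℕₚ.*-distribˡ-+ (suc e) (2 ^ e) (2 ^ e)))
                         (cong (λ n → suc e * (2 ^ e + n)) (sym (ℕₚ.+-identityʳ (2 ^ e))))

private
  prefixed : ∀ {d a} {xs : List (Vec ℕ d)} (P : Vec ℕ (suc d) → Set) →
    (∀ u → u ∈ xs → P (a ∷ u)) → ∀ {v} → v ∈ List.map (a ∷_) xs → P v
  prefixed _ P-∷ v∈ with ∈-map⁻ _ v∈
  ... | u , u∈ , refl = P-∷ u u∈

  InV-∷ : ∀ {d a} {u : Vec ℕ d} → a ≤ 2 → InV u → InV (a ∷ u)
  InV-∷ a≤2 _   zero    = a≤2
  InV-∷ _   u∈V (suc i) = u∈V i

  InVi-0∷ : ∀ {d i} (u : Vec ℕ d) → InVi i u → InVi i (0 ∷ u)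
  InVi-0∷ _ (u∈V , c) = InV-∷ z≤n u∈V , c

  InVi-1∷ : ∀ {d i} (u : Vec ℕ d) → InVi i u → InVi (suc i) (1 ∷ u)
  InVi-1∷ _ (u∈V , c) = InV-∷ (s≤s z≤n) u∈V , cong suc c

  InVi-2∷ : ∀ {d i} (u : Vec ℕ d) → InVi i u → InVi i (2 ∷ u)
  InVi-2∷ _ (u∈V , c) = InV-∷ (s≤s (s≤s z≤n)) u∈V , c

V₀-list⇒V₀ : ∀ d {v} → v ∈ V₀-list d → InVi 0 v
V₀-list⇒V₀ zero    (here refl) = (λ ()) , refl
V₀-list⇒V₀ (suc d) v∈ with ∈-++⁻ (List.map (0 ∷_) (V₀-list d)) v∈
... | inj₁ v∈0s = prefixed (InVi 0) (λ u → InVi-0∷ u ∘ V₀-list⇒V₀ d) v∈0s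
... | inj₂ v∈2s = prefixed (InVi 0) (λ u → InVi-2∷ u ∘ V₀-list⇒V₀ d) v∈2s

V₀⇒V₀-list : ∀ d (v : Vec ℕ d) → InVi 0 v → v ∈ V₀-list d
V₀⇒V₀-list zero    []       _         = here refl
V₀⇒V₀-list (suc d) (0 ∷ u)  (v∈V , c) = ∈-++⁺ˡ (∈-map⁺ (0 ∷_) (V₀⇒V₀-list d u (v∈V ∘ suc , c)))
V₀⇒V₀-list (suc d) (2 ∷ u)  (v∈V , c) =
  ∈-++⁺ʳ (List.map (0 ∷_) (V₀-list d)) (∈-map⁺ (2 ∷_) (V₀⇒V₀-list d u (v∈V ∘ suc , c)))
V₀⇒V₀-list (suc d) (1 ∷ u)  (_ , ())
V₀⇒V₀-list (suc d) (suc (suc (suc a)) ∷ u) (v∈V , _) with v∈V zero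
... | s≤s (s≤s ())

V₁-list⇒V₁ : ∀ d {v} → v ∈ V₁-list d → InVi 1 v
V₁-list⇒V₁ (suc d) v∈ with ∈-++⁻ (List.map (1 ∷_) (V₀-list d)) v∈
... | inj₁ v∈1s = prefixed (InVi 1) (λ u → InVi-1∷ u ∘ V₀-list⇒V₀ d) v∈1s
... | inj₂ v∈rest with ∈-++⁻ (List.map (0 ∷_) (V₁-list d)) v∈rest
...   | inj₁ v∈0s = prefixed (InVi 1) (λ u → InVi-0∷ u ∘ V₁-list⇒V₁ d) v∈0s
...   | inj₂ v∈2s = prefixed (InVi 1) (λ u → InVi-2∷ u ∘ V₁-list⇒V₁ d) v∈2s

V₁⇒V₁-list : ∀ d (v : Vec ℕ d) → InVi 1 v → v ∈ V₁-list d
V₁⇒V₁-list (suc d) (1 ∷ u) (v∈V , c) = ∈-++⁺ˡ (∈-map⁺ (1 ∷_) (V₀⇒V₀-list d u (v∈V ∘ suc , ℕₚ.suc-injective c)))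
V₁⇒V₁-list (suc d) (0 ∷ u) (v∈V , c) =
  ∈-++⁺ʳ (List.map (1 ∷_) (V₀-list d)) (∈-++⁺ˡ (∈-map⁺ (0 ∷_) (V₁⇒V₁-list d u (v∈V ∘ suc , c))))
V₁⇒V₁-list (suc d) (2 ∷ u) (v∈V , c) =
  ∈-++⁺ʳ (List.map (1 ∷_) (V₀-list d))
    (∈-++⁺ʳ (List.map (0 ∷_) (V₁-list d)) (∈-map⁺ (2 ∷_) (V₁⇒V₁-list d u (v∈V ∘ suc , c))))
V₁⇒V₁-list (suc d) (suc (suc (suc a)) ∷ u) (v∈V , _) with v∈V zero
... | s≤s (s≤s ())

V₁-card : ∀ d → HasCard (InVi {d} 1) (d * 2 ^ (d ∸ 1))
V₁-card d = V₁-list d , Unique-V₁-list d , (λ v → mk⇔ (V₁-list⇒V₁ d) (V₁⇒V₁-list d v)) , length-V₁-list d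

proposition4p4 : (d : ℕ) → 1 Data.Nat.≤ d →
    ((v : Vec ℕ d) → Image 1 d 2 v ⇔ (InV v × ¬ InVi 0 v))
    × ((w : Vec ℚ d) → IsVertex (Conv (ImageQ 1 d 2)) w ⇔ (∃ λ v → InVi 1 v × embed v ≡ w))
    × u≡ 1 2 d (d * 2 ^ (d ∸ 1))
proposition4p4 d _ = Image⇔V∖V₀ , vertex⇔V₁ , HasCard-image embed embed-injective vertex⇔V₁ (V₁-card d)
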